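{- Let $\mu$ denote the minimum of $\tau(G)$ over all finite simple graphs $G$ with at least one edge. Then $\frac{3}{2}\le \mu<2$.
   Context: A vertex colouring $\varphi$ of a graph $G$ is a Thue colouring if there is no integer $m\ge 1$ and no path $v_1\cdots v_{2m}$ in $G$ (distinct vertices, consecutive ones adjacent) with $\varphi(v_i)=\varphi(v_{i+m})$ for all $1\le i\le m$. The Thue chromatic number $\pi(G)$ is the minimum number of colours in a Thue colouring of $G$ (for disconnected $G$, the maximum over components). For a graph $G$ with $\epsilon$ edges, an edge deletion sequence is an ordering $(f_1,\dots,f_\epsilon)$ of $E(G)$; it defines $G^*_0=G$ and $G^*_i=G^*_{i-1}-f_i$ for $1\le i\le\epsilon$ (vertices are kept), and its $\tau$-value is $\frac{1}{\epsilon+1}\sum_{i=0}^{\epsilon}\pi(G^*_i)$. The $\tau$-index $\tau(G)$ is the minimum of the $\tau$-values over all $\epsilon!$ edge deletion sequences. -}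

module Defs where

open import Data.Nat using (ℕ; zero; suc; _+_; _*_; _≤_; _<_)
open import Data.Fin using (Fin) renaming (_<_ to _<ᶠ_)
open import Data.Product using (_×_; _,_; Σ; ∃)
open import Data.Sum using (_⊎_)
open import Data.List using (List; []; length; map; take; drop; upTo)
open import Data.Nat.ListAction using (sum)
open import Data.List.Membership.Propositional using (_∈_)
open import Data.List.Relation.Unary.All using (All)
open import Data.List.Relation.Unary.Linked using (Linked)
open import Data.List.Relation.Unary.Unique.Propositional using (Unique)
open import Relation.Binary.PropositionalEquality using (_≡_; _≢_)

-- A graph on the vertex set Fin n is given by its list of edges.
Edge : ℕ → Set
Edge n = Fin n × Fin n

-- Finite simple graph: every edge (u , v) is stored once, with u < v
-- (so no loops, no multi-edges).
SimpleGraph : (n : ℕ) → List (Edge n) → Set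
SimpleGraph n E = All (λ e → Data.Product.proj₁ e <ᶠ Data.Product.proj₂ e) E × Unique E

Adj : {n : ℕ} → List (Edge n) → Fin n → Fin n → Set
Adj E u v = ((u , v) ∈ E) ⊎ ((v , u) ∈ E)

IsPath : {n : ℕ} → List (Edge n) → List (Fin n) → Set
IsPath E p = Unique p × Linked (Adj E) p

IsThueColouring : {n : ℕ} → List (Edge n) → (k : ℕ) → (Fin n → Fin k) → Set
IsThueColouring {n} E k φ =
  (m : ℕ) → 1 ≤ m → (p : List (Fin n)) → length p ≡ m + m → IsPath E p →
  map φ (take m p) ≢ map φ (drop m p)

ThueColourable : {n : ℕ} → List (Edge n) → ℕ → Set
ThueColourable {n} E k = Σ (Fin n → Fin k) (IsThueColouring E k)

IsThueNumber : (n : ℕ) → List (Edge n) → ℕ → Set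
IsThueNumber n E k = ThueColourable E k × ((j : ℕ) → ThueColourable E j → k ≤ j)

-- For an edge deletion sequence σ (an ordering of E), G*_i has edge list drop i σ.
-- s is the sum  Σ_{i=0}^{ε} π(G*_i)  (ε = length σ).
IsDeletionSum : (n : ℕ) → List (Edge n) → ℕ → Set
IsDeletionSum n σ s =
  ∃ λ (π : ℕ → ℕ) →
    ((i : ℕ) → i ≤ length σ → IsThueNumber n (drop i σ) (π i)) ×
    (s ≡ sum (map π (upTo (suc (length σ)))))

module Submission where

open import Defs
open import Data.Nat using (ℕ; suc; _*_; _≤_; _<_)
open import Data.Product using (_×_; ∃)
open import Data.List using (List; []; length)
open import Data.List.Relation.Binary.Permutation.Propositional using (_↭_)
open import Relation.Binary.PropositionalEquality using (_≢_)

open import Data.Nat using (zero; _+_; z≤n; s≤s)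
import Data.Nat.Properties
open import Data.Nat.Properties using (*-suc; m≤m+n; m≤n+m; +-mono-≤; *-monoʳ-≤; ≤-trans; ≤-refl; <⇒≤)
open import Data.Nat.Tactic.RingSolver using (solve-∀)
open import Data.Fin using (Fin) renaming (zero to 0F; suc to sucF)
open import Data.Fin.Properties using (<⇒≢)
open import Data.Product using (_,_; proj₁; proj₂)
open import Data.Sum using (inj₁; inj₂)
open import Data.List using (_∷_; drop; applyUpTo)
open import Data.List.Properties using (map-upTo; ∷-injectiveˡ)
open import Data.Nat.ListAction using (sum)
open import Data.List.Membership.Propositional using (_∈_; find)
open import Data.List.Relation.Unary.Any using (Any; here)
import Data.List.Relation.Unary.Any as Any
open import Data.List.Relation.Unary.All using (All; []; _∷_)
open import Data.List.Relation.Unary.Linked using ([-]; _∷_)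
open import Data.List.Relation.Unary.AllPairs using ([]; _∷_)
open import Data.List.Relation.Binary.Permutation.Propositional using (↭-refl; ↭-sym)
open import Data.List.Relation.Binary.Permutation.Propositional.Properties using (All-resp-↭; ↭-length)
open import Relation.Binary.PropositionalEquality using (_≡_; refl; sym; trans; cong; subst)
open import Function using (id; _∘_)
open import Data.Empty using (⊥; ⊥-elim)

-- Lower bound: for an edge deletion sequence σ of a graph with
-- ε ≥ 1 edges, every graph G*_i with i < ε still has an edge, and an edge
-- u v is a path whose colour word φ(u)φ(v) must not be a square, so
-- π(G*_i) ≥ 2; the last graph G*_ε has a vertex, so π(G*_ε) ≥ 1.  Hence the
-- sum of the π-values is at least 2ε + 1, and (2ε + 1)/(ε + 1) ≥ 3/2 as
-- soon as ε ≥ 1.  Upper bound: K₂ with its only deletion sequence has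
-- π-values 2, 1, so its τ-value is 3/2 < 2.

Proper : {n k : ℕ} → List (Edge n) → (Fin n → Fin k) → Set
Proper E φ = ∀ {u v} → Adj E u v → φ u ≢ φ v

vertex⇒one-colour : {n k : ℕ} (E : List (Edge n)) → Fin n → ThueColourable E k → 1 ≤ k
vertex⇒one-colour E x (φ , _) = nonempty (φ x)
  where
  nonempty : {k : ℕ} → Fin k → 1 ≤ k
  nonempty 0F = s≤s z≤n
  nonempty (sucF _) = s≤s z≤n

edge-path : {n : ℕ} {E : List (Edge n)} {u v : Fin n} →
            (u , v) ∈ E → u ≢ v → IsPath E (u ∷ v ∷ [])
edge-path u,v∈E u≢v = (u≢v ∷ []) ∷ [] ∷ [] , inj₁ u,v∈E ∷ [-]

-- Since the path u v must not carry the square φ(u)φ(v), every Thue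
-- colouring of a graph with a non-loop edge uses at least two colours.
edge⇒two-colours : {n k : ℕ} (E : List (Edge n)) →
                   Any (λ e → proj₁ e ≢ proj₂ e) E → ThueColourable E k → 2 ≤ k
edge⇒two-colours E nonloop (φ , thue) with find nonloop
... | (u , v) , u,v∈E , u≢v =
  distinct (φ u) (φ v) λ φu≡φv →
    thue 1 ≤-refl (u ∷ v ∷ []) refl (edge-path u,v∈E u≢v) (cong (_∷ []) φu≡φv)
  where
  distinct : {k : ℕ} (a b : Fin k) → a ≢ b → 2 ≤ k
  distinct {suc zero} 0F 0F a≢b = ⊥-elim (a≢b refl)
  distinct {suc (suc _)} _ _ _ = s≤s (s≤s z≤n)

-- If no path has more than two vertices, the only squares to avoid are the
-- colour words of edges, so every proper colouring is a Thue colouring.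
short-paths⇒Thue : {n k : ℕ} (E : List (Edge n)) (φ : Fin n → Fin k) →
                   (∀ p → IsPath E p → length p ≤ 2) → Proper E φ →
                   IsThueColouring E k φ
short-paths⇒Thue E φ short proper (suc _) _ [] () _
short-paths⇒Thue E φ short proper (suc zero) _ (_ ∷ []) () _
short-paths⇒Thue E φ short proper (suc (suc _)) _ (_ ∷ []) () _
short-paths⇒Thue E φ short proper (suc zero) _ (a ∷ b ∷ []) _ (_ , a~b ∷ _) =
  proper a~b ∘ ∷-injectiveˡ
short-paths⇒Thue E φ short proper (suc (suc zero)) _ (_ ∷ _ ∷ []) () _
short-paths⇒Thue E φ short proper (suc (suc (suc _))) _ (_ ∷ _ ∷ []) () _
short-paths⇒Thue E φ short proper (suc _) _ (_ ∷ _ ∷ _ ∷ _) _ path with short _ path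
... | s≤s (s≤s ())

-- In an edgeless graph no two vertices are adjacent, so one colour is a
-- Thue colouring, and it is optimal as soon as there is a vertex.
edgeless-Thue-number : {n : ℕ} → Fin n → IsThueNumber n [] 1
edgeless-Thue-number x =
  ((λ _ → 0F) , short-paths⇒Thue [] _ short (λ { (inj₁ ()) ; (inj₂ ()) })) ,
  λ j → vertex⇒one-colour [] x
  where
  short : ∀ p → IsPath [] p → length p ≤ 2
  short [] _ = z≤n
  short (_ ∷ []) _ = s≤s z≤n
  short (_ ∷ _ ∷ _) (_ , inj₁ () ∷ _)
  short (_ ∷ _ ∷ _) (_ , inj₂ () ∷ _)

K₂ : List (Edge 2)
K₂ = (0F , sucF 0F) ∷ []

K₂-simple : SimpleGraph 2 K₂
K₂-simple = (s≤s z≤n ∷ []) , ([] ∷ [])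

-- A path has distinct vertices, so on the vertex set Fin 2 it has at most two.
path-in-Fin2 : (E : List (Edge 2)) (p : List (Fin 2)) → IsPath E p → length p ≤ 2
path-in-Fin2 E [] _ = z≤n
path-in-Fin2 E (_ ∷ []) _ = s≤s z≤n
path-in-Fin2 E (_ ∷ _ ∷ []) _ = s≤s (s≤s z≤n)
path-in-Fin2 E (a ∷ b ∷ c ∷ _) ((a≢b ∷ a≢c ∷ _) ∷ (b≢c ∷ _) ∷ _ , _) =
  ⊥-elim (no-three-distinct a b c a≢b a≢c b≢c)
  where
  no-three-distinct : (a b c : Fin 2) → a ≢ b → a ≢ c → b ≢ c → ⊥
  no-three-distinct 0F        0F        _         a≢b _   _   = a≢b refl
  no-three-distinct 0F        (sucF 0F) 0F        _   a≢c _   = a≢c refl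
  no-three-distinct 0F        (sucF 0F) (sucF 0F) _   _   b≢c = b≢c refl
  no-three-distinct (sucF 0F) 0F        0F        _   _   b≢c = b≢c refl
  no-three-distinct (sucF 0F) 0F        (sucF 0F) _   a≢c _   = a≢c refl
  no-three-distinct (sucF 0F) (sucF 0F) _         a≢b _   _   = a≢b refl

-- Colouring K₂ by the identity is proper, and an edge needs two colours.
K₂-Thue-number : IsThueNumber 2 K₂ 2
K₂-Thue-number =
  (id , short-paths⇒Thue K₂ id (path-in-Fin2 K₂) proper) ,
  λ j → edge⇒two-colours K₂ (here λ ())
  where
  proper : Proper K₂ id
  proper (inj₁ (here refl)) ()
  proper (inj₂ (here refl)) ()

suffix-witness : {A : Set} {P : A → Set} (i : ℕ) (xs : List A) →
                 i < length xs → All P xs → Any P (drop i xs)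
suffix-witness zero    (x ∷ xs) _         (px ∷ _)   = here px
suffix-witness (suc i) (x ∷ xs) (s≤s i<l) (_ ∷ pxs) = suffix-witness i xs i<l pxs

sum-lower-bound : (g : ℕ → ℕ) (L : ℕ) → (∀ i → i < L → 2 ≤ g i) → 1 ≤ g L →
                  suc (2 * L) ≤ sum (applyUpTo g (suc L))
sum-lower-bound g zero    _   last = ≤-trans last (m≤m+n (g 0) 0)
sum-lower-bound g (suc L) two last = begin
  suc (2 * suc L)                   ≡⟨ cong suc (*-suc 2 L) ⟩
  2 + suc (2 * L)                   ≤⟨ +-mono-≤ (two 0 (s≤s z≤n))
                                         (sum-lower-bound (g ∘ suc) L (λ i → two (suc i) ∘ s≤s) last) ⟩
  g 0 + sum (applyUpTo (g ∘ suc) (suc L)) ∎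
  where open Data.Nat.Properties.≤-Reasoning

-- (2L + 1)/(L + 1) ≥ 3/2 once L ≥ 1: indeed 2(2L + 1) = 3(L + 1) + (L - 1).
three-halves : (L : ℕ) → 1 ≤ L → 3 * suc L ≤ 2 * suc (2 * L)
three-halves (suc k) _ = subst (3 * suc (suc k) ≤_) (excess k) (m≤n+m _ k)
  where
  excess : (k : ℕ) → k + 3 * suc (suc k) ≡ 2 * suc (2 * suc k)
  excess = solve-∀

-- The lower bound τ ≥ 3/2: every deletion sequence of a simple graph with an
-- edge has π-sum s ≥ 2ε + 1, hence 3(ε + 1) ≤ 2s.
deletion-sum-lower-bound :
  (n : ℕ) (E : List (Edge n)) → SimpleGraph n E → E ≢ [] →
  (σ : List (Edge n)) → σ ↭ E → (s : ℕ) → IsDeletionSum n σ s →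
  3 * suc (length E) ≤ 2 * s
deletion-sum-lower-bound n [] _ E≢[] _ _ _ _ = ⊥-elim (E≢[] refl)
deletion-sum-lower-bound n ((u , _) ∷ _) (ordered , _) _ σ σ↭E s (π , thue-number , s≡sum)
  = subst (λ ε → 3 * suc ε ≤ 2 * s) (↭-length σ↭E)
      (≤-trans (three-halves (length σ) ε≥1)
               (*-monoʳ-≤ 2 (subst (suc (2 * length σ) ≤_) sum≡s
                 (sum-lower-bound π (length σ) two-before-end one-at-end))))
  where
  ε≥1 : 1 ≤ length σ
  ε≥1 = subst (1 ≤_) (↭-length (↭-sym σ↭E)) (s≤s z≤n)
  sum≡s : sum (applyUpTo π (suc (length σ))) ≡ s
  sum≡s = sym (trans s≡sum (cong sum (map-upTo π (suc (length σ)))))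
  two-before-end : ∀ i → i < length σ → 2 ≤ π i
  two-before-end i i<ε =
    edge⇒two-colours (drop i σ)
      (Any.map <⇒≢ (suffix-witness i σ i<ε (All-resp-↭ (↭-sym σ↭E) ordered)))
      (proj₁ (thue-number i (<⇒≤ i<ε)))
  one-at-end : 1 ≤ π (length σ)
  one-at-end = vertex⇒one-colour (drop (length σ) σ) u (proj₁ (thue-number (length σ) ≤-refl))

-- The upper bound τ < 2: K₂ with its only deletion sequence has π-values
-- 2 and 1, so its π-sum is 3 < 2 · 2.
K₂-deletion-sum : IsDeletionSum 2 K₂ 3
K₂-deletion-sum = π , thue-number , refl
  where
  π : ℕ → ℕ
  π zero    = 2
  π (suc _) = 1
  thue-number : (i : ℕ) → i ≤ 1 → IsThueNumber 2 (drop i K₂) (π i)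
  thue-number zero       _           = K₂-Thue-number
  thue-number (suc zero) _           = edgeless-Thue-number 0F
  thue-number (suc (suc _)) (s≤s ())

theorem2p4 : ((n : ℕ) (E : List (Edge n)) → SimpleGraph n E → E ≢ [] →
    (σ : List (Edge n)) → σ ↭ E → (s : ℕ) → IsDeletionSum n σ s →
    3 * suc (length E) ≤ 2 * s)
    ×
    (∃ λ (n : ℕ) → ∃ λ (E : List (Edge n)) → SimpleGraph n E × E ≢ [] ×
    ∃ λ (σ : List (Edge n)) → σ ↭ E × ∃ λ (s : ℕ) → IsDeletionSum n σ s ×
    s < 2 * suc (length E))
theorem2p4 =
  deletion-sum-lower-bound ,
  (2 , K₂ , K₂-simple , (λ ()) , K₂ , ↭-refl , 3 , K₂-deletion-sum , ≤-refl)
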